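{- Fix an integer $g>2$. Consider a vertex set $Z$ and its $g$-sphere-cover $\bigcirc_gZ$, and a triple of vertices $T$ in $Z$. Let $\mathcal{E}\subseteq\mathcal{B}^{\bigcirc}(T)$ be a non-empty set of at most $g$ edge-disjoint triangles. \begin{enumerate} \item There is $v\in V(\mathcal{B}^{\bigcirc}(T))\setminus V(T)$ which appears in exactly one of the triangles in $\mathcal{E}$. \item $|V(\mathcal{E})\setminus V(T)|\ge|\mathcal{E}|$. \end{enumerate}
   Context: The $g$-sphere-cover of a vertex set $Z$ is the graph $\bigcirc_gZ$ obtained as follows. For every triple $T$ of distinct vertices of $Z$, arbitrarily label these vertices as $a,b_1,b_2$, and append a ``$g$-sphere'' to the triple: add $2g-1$ new vertices $b_3,\ldots,b_{2g},c$ (new for each triple), then add the edges $ab_j$ for $3\le j\le 2g$, the edges $cb_j$ for $1\le j\le 2g$, the edges $b_jb_{j+1}$ for $2\le j\le 2g-1$, and the edge $b_{2g}b_1$. The out-decomposition of this $g$-sphere consists of the triangles $c b_2 b_3,\,ab_3 b_4,\, c b_4b_5,\, a b_5 b_6,\dots,cb_{2g}b_1$; the in-decomposition (a triangle-decomposition of the $g$-sphere together with the edges of $T$) consists of the triangles $cb_1b_2,\,ab_2b_3,\,cb_3b_4,\,a b_4 b_5,\dots,ab_{2g}b_1$. For a triple $T$ in $Z$, $\mathcal{B}^{\bigcirc}(T)$ denotes the set of all triangles in the in- and out-decompositions of the $g$-sphere associated to $T$ (note $T\notin\mathcal{B}^{\bigcirc}(T)$). For a set of triangles $\mathcal R$,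 $V(\mathcal R)$ is the set of vertices of these triangles. -}

module Defs where

open import Data.Nat using (ℕ; zero; suc; _+_; _*_; _≤_; _<_; z≤n; s≤s; _≤?_)
open import Data.Nat.Properties using (≤-trans)
open import Data.Fin using (Fin; toℕ) renaming (zero to f0; suc to fs)
open import Data.Fin.Properties using (toℕ<n)
open import Data.Bool using (Bool; true; false; if_then_else_)
open import Data.Product using (proj₁; proj₂; Σ; Σ-syntax; _×_; _,_; ∃; ∃-syntax)
open import Data.Sum using (_⊎_)
open import Data.List using (List; length; lookup)
open import Data.List.Relation.Unary.Any using (Any)
open import Relation.Nullary using (¬_; yes; no)
open import Relation.Binary.PropositionalEquality using (_≡_; _≢_)

-- The ground vertex set Z = Fin n and its (unordered) triples,
-- represented canonically as x < y < z.

Triple : ℕ → Set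
Triple n = Σ[ x ∈ Fin n ] Σ[ y ∈ Fin n ] Σ[ z ∈ Fin n ] (toℕ x < toℕ y × toℕ y < toℕ z)

-- The six orderings of a 3-tuple; the "arbitrary labelling" a,b₁,b₂ of a
-- triple is given by a choice Fin 6 per triple.
perm : {A : Set} → Fin 6 → A × A × A → A × A × A
perm f0                               (x , y , z) = x , y , z
perm (fs f0)                          (x , y , z) = x , z , y
perm (fs (fs f0))                     (x , y , z) = y , x , z
perm (fs (fs (fs f0)))                (x , y , z) = y , z , x
perm (fs (fs (fs (fs f0))))           (x , y , z) = z , x , y
perm (fs (fs (fs (fs (fs f0)))))      (x , y , z) = z , y , x

Labelling : ℕ → Set
Labelling n = Triple n → Fin 6

-- New vertices of one g-sphere: b_{k+3} (for k + 3 ≤ 2g) and c.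

data New (g : ℕ) : Set where
  bnew : (k : ℕ) → .(3 + k ≤ 2 * g) → New g
  cnew : New g

Vertex : ℕ → ℕ → Set
Vertex n g = Fin n ⊎ (Triple n × New g)

open Data.Sum using (inj₁; inj₂)

even : ℕ → Bool
even zero = true
even (suc zero) = false
even (suc (suc k)) = even k

-- A triangle is given by its three vertices; it is identified with its vertex set.
Tri' : Set → Set
Tri' V = V × V × V

_∈ₜ_ : {V : Set} → V → Tri' V → Set
v ∈ₜ (x , y , z) = v ≡ x ⊎ v ≡ y ⊎ v ≡ z

SameTri : {V : Set} → Tri' V → Tri' V → Set
SameTri τ σ = ∀ v → (v ∈ₜ τ → v ∈ₜ σ) × (v ∈ₜ σ → v ∈ₜ τ)

ShareEdge : {V : Set} → Tri' V → Tri' V → Set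
ShareEdge τ σ = Σ _ λ u → Σ _ λ v → u ≢ v × u ∈ₜ τ × v ∈ₜ τ × u ∈ₜ σ × v ∈ₜ σ

InVE : {V : Set} → List (Tri' V) → V → Set
InVE E v = Any (v ∈ₜ_) E

ExactlyOne : {V : Set} → List (Tri' V) → V → Set
ExactlyOne E v = Σ[ i ∈ Fin (length E) ] (v ∈ₜ lookup E i × (∀ j → v ∈ₜ lookup E j → j ≡ i))

module Sphere {n g : ℕ} (lab : Labelling n) (t : Triple n) where

  labelled : Fin n × Fin n × Fin n
  labelled = perm (lab t) (proj₁ t , proj₁ (proj₂ t) , proj₁ (proj₂ (proj₂ t)))

  Tri : Set
  Tri = Tri' (Vertex n g)

  a b₁ b₂ c : Vertex n g
  a  = inj₁ (proj₁ labelled)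
  b₁ = inj₁ (proj₁ (proj₂ labelled))
  b₂ = inj₁ (proj₂ (proj₂ labelled))
  c  = inj₂ (t , cnew)

  -- bAt i p  is the vertex b_{i+1}
  bAt : (i : ℕ) → .(suc i ≤ 2 * g) → Vertex n g
  bAt zero _ = b₁
  bAt (suc zero) _ = b₂
  bAt (suc (suc k)) p = inj₂ (t , bnew k p)

  -- the cyclic successor b_{i+2} (with b_{2g+1} = b₁)
  bNext : (i : ℕ) → .(suc i ≤ 2 * g) → Vertex n g
  bNext i p with suc (suc i) ≤? 2 * g
  ... | yes q = bAt (suc i) q
  ... | no _  = bAt zero (≤-trans (s≤s z≤n) p)


  -- Triangles x b_{i+1} b_{i+2}  (paper's index j = i + 1, cyclic mod 2g)
  triAt : Vertex n g → (i : ℕ) → .(suc i ≤ 2 * g) → Tri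
  triAt x i p = x , bAt i p , bNext i p

  -- In-decomposition: c b₁b₂, a b₂b₃, c b₃b₄, …, a b_{2g}b₁
  -- (paper index j odd ↦ c, j even ↦ a; i.e. i even ↦ c, i odd ↦ a).
  inTri : Fin (2 * g) → Tri
  inTri i = triAt (if even (toℕ i) then c else a) (toℕ i) (toℕ<n i)

  -- Out-decomposition: c b₂b₃, a b₃b₄, …, c b_{2g}b₁
  -- (paper index j = 2,…,2g, j even ↦ c, j odd ↦ a; i.e. i ≥ 1, i odd ↦ c).
  outTri : (i : Fin (2 * g)) → Tri
  outTri i = triAt (if even (toℕ i) then a else c) (toℕ i) (toℕ<n i)

  InB : Tri → Set
  InB τ = (Σ[ i ∈ Fin (2 * g) ] SameTri τ (inTri i))
        ⊎ (Σ[ i ∈ Fin (2 * g) ] (toℕ i ≢ 0 × SameTri τ (outTri i)))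

  InVB : Vertex n g → Set
  InVB v = Σ[ τ ∈ Tri ] (InB τ × v ∈ₜ τ)

  InVT : Vertex n g → Set
  InVT v = v ≡ a ⊎ v ≡ b₁ ⊎ v ≡ b₂

-- Every triangle of 𝓑○(T) is x b_{i+1} b_{i+2} with apex x ∈ {a, c} and a position i < 2g
-- (b indices mod 2g), and two triangles at the same position share the edge b_{i+1} b_{i+2};
-- so the triangles of 𝓔 sit at distinct positions, and since |𝓔| ≤ g some position
-- j ∈ [1, g + 1] is free, with j + 2 ≤ 2g because g > 2.
-- (1) If every triangle of 𝓔 sits at position 0 there is only one, and c is the vertex.
-- Otherwise, walking from j to an occupied position s ≥ 1 we meet an i ≥ 1 such that exactly
-- one of i, i + 1 is occupied; b_{i+2} lies only on the triangles at positions i and i + 1.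
-- (2) Represent the triangle at position i by c if i = 0, by b_{i+2} if 0 < i < j and by
-- b_{i+1} if i > j; the position is recovered from the vertex, so these are distinct.

module Submission where

open import Defs
open import Data.Nat using (ℕ; _≤_; _<_)
open import Data.Product using (Σ; Σ-syntax; _×_)
open import Data.List using (List; []; length)
open import Data.List.Relation.Unary.All using (All)
open import Data.List.Relation.Unary.Unique.Propositional using (Unique)
open import Data.List.Relation.Unary.AllPairs using (AllPairs)
open import Relation.Nullary using (¬_)
open import Relation.Binary.PropositionalEquality using (_≢_)

open import Data.Bool using (Bool; true; false; if_then_else_)
import Data.Bool as Bool
open import Data.Fin using (Fin; toℕ) renaming (zero to f0; suc to fs)
open import Data.Fin.Properties using (toℕ<n; any?; all?; ¬∀⟶∃¬; pigeonhole)
import Data.Fin.Properties as Fin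
open import Data.List using (_∷_; lookup; tabulate)
open import Data.List.Properties using (length-tabulate)
open import Data.List.Membership.Propositional using (lose)
open import Data.List.Membership.Propositional.Properties using (∈-lookup)
open import Data.List.Relation.Unary.AllPairs using (_∷_)
import Data.List.Relation.Unary.All as All
import Data.List.Relation.Unary.All.Properties as All
import Data.List.Relation.Unary.Unique.Propositional.Properties as Unique
open import Data.Nat using (zero; suc; _*_; _+_; z≤n; s≤s; _≟_; _≤?_; _<?_)
open import Data.Nat.Properties
open import Data.Product using (_,_; proj₁; proj₂; ∃-syntax)
open import Data.Sum using (_⊎_; inj₁; inj₂; [_,_]′)
open import Data.Sum.Properties using (inj₁-injective)
open import Function using (_∘_)
open import Relation.Binary.Definitions using (tri<; tri≈; tri>)
open import Relation.Binary.PropositionalEquality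
  using (_≡_; refl; sym; trans; cong; subst; module ≡-Reasoning)
open import Relation.Nullary using (Dec; yes; no; does; contradiction)

does-distinct : {A B : Set} (A? : Dec A) (B? : Dec B) → ¬ A → B → does A? ≢ does B?
does-distinct (yes a) _       ¬a _ = contradiction a ¬a
does-distinct _       (no ¬b) _  b = contradiction b ¬b
does-distinct (no _)  (yes _) _  _ ()

change-point : (f : ℕ → Bool) {lo hi : ℕ} → lo ≤ hi → f lo ≢ f hi →
               ∃[ i ] (lo ≤ i × i < hi × f i ≢ f (suc i))
change-point f {hi = zero} z≤n differ = contradiction refl differ
change-point f {lo} {suc h} lo≤ differ with m≤n⇒m<n∨m≡n lo≤
... | inj₂ refl = contradiction refl differ
... | inj₁ (s≤s lo≤h) with f h Bool.≟ f (suc h)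
...   | no step = h , lo≤h , ≤-refl , step
...   | yes same with change-point f lo≤h (λ e → differ (trans e same))
...     | i , lo≤i , i<h , step = i , lo≤i , m<n⇒m<1+n i<h , step

change-point-within : (f : ℕ → Bool) {a b m m′ : ℕ} → a ≤ m → a ≤ m′ → m < b → m′ < b →
                      f m ≢ f m′ → ∃[ i ] (a ≤ i × suc i < b × f i ≢ f (suc i))
change-point-within f {m = m} {m′} a≤m a≤m′ m<b m′<b differ with ≤-total m m′
... | inj₁ m≤m′ with change-point f m≤m′ differ
...   | i , m≤i , i<m′ , step = i , ≤-trans a≤m m≤i , ≤-trans (s≤s i<m′) m′<b , step
change-point-within f {m = m} {m′} a≤m a≤m′ m<b m′<b differ
    | inj₂ m′≤m with change-point f m′≤m (differ ∘ sym)
...   | i , m′≤i , i<m , step = i , ≤-trans a≤m′ m′≤i , ≤-trans (s≤s i<m) m<b , step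

missed-value : ∀ {m} (f : Fin m → ℕ) → ∃[ j ] (1 ≤ j × j ≤ suc m × ¬ (∃[ r ] f r ≡ j))
missed-value {m} f with all? (λ (k : Fin (suc m)) → any? (λ r → f r ≟ suc (toℕ k)))
... | yes hit with pigeonhole ≤-refl (λ k → proj₁ (hit k))
...   | k , k′ , k<k′ , same = contradiction (suc-injective value-k≡value-k′) (<⇒≢ k<k′)
  where
  value-k≡value-k′ : suc (toℕ k) ≡ suc (toℕ k′)
  value-k≡value-k′ = trans (sym (proj₂ (hit k))) (trans (cong f same) (proj₂ (hit k′)))
missed-value {m} f | no miss with ¬∀⟶∃¬ _ _ (λ k → any? (λ r → f r ≟ suc (toℕ k))) miss
... | k , unhit = suc (toℕ k) , s≤s z≤n , toℕ<n k , unhit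

allPairs-lookup : {A : Set} {R : A → A → Set} {xs : List A} → AllPairs R xs →
                  ∀ {i j : Fin (length xs)} → toℕ i < toℕ j → R (lookup xs i) (lookup xs j)
allPairs-lookup (Rx ∷ _)  {f0}   {fs j} _         = All.lookup Rx (∈-lookup j)
allPairs-lookup (_ ∷ Rxs) {fs i} {fs j} (s≤s i<j) = allPairs-lookup Rxs i<j

nonempty-index : {A : Set} {xs : List A} → xs ≢ [] → Fin (length xs)
nonempty-index {xs = []}    xs≢[] = contradiction refl xs≢[]
nonempty-index {xs = _ ∷ _} _     = f0

perm-distinct : {A : Set} (k : Fin 6) {x y z : A} → x ≢ y → x ≢ z → y ≢ z →
                proj₁ (proj₂ (perm k (x , y , z))) ≢ proj₂ (proj₂ (perm k (x , y , z)))
perm-distinct f0                               x≢y x≢z y≢z = y≢z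
perm-distinct (fs f0)                          x≢y x≢z y≢z = y≢z ∘ sym
perm-distinct (fs (fs f0))                     x≢y x≢z y≢z = x≢z
perm-distinct (fs (fs (fs f0)))                x≢y x≢z y≢z = x≢z ∘ sym
perm-distinct (fs (fs (fs (fs f0))))           x≢y x≢z y≢z = x≢y
perm-distinct (fs (fs (fs (fs (fs f0)))))      x≢y x≢z y≢z = x≢y ∘ sym

3+g≤2*g : ∀ {g} → 2 < g → 3 + g ≤ 2 * g
3+g≤2*g {g} 2<g = ≤-trans (+-monoˡ-≤ g 2<g) (≤-reflexive (cong (g +_) (sym (+-identityʳ g))))

module Cover {n g : ℕ} (lab : Labelling n) (t : Triple n) where
  open Sphere {n} {g} lab t

  b₁≢b₂ : b₁ ≢ b₂
  b₁≢b₂ = perm-distinct (lab t) (ordered x<y) (ordered (<-trans x<y y<z)) (ordered y<z)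
        ∘ inj₁-injective
    where
    x<y : toℕ (proj₁ t) < toℕ (proj₁ (proj₂ t))
    x<y = proj₁ (proj₂ (proj₂ (proj₂ t)))
    y<z : toℕ (proj₁ (proj₂ t)) < toℕ (proj₁ (proj₂ (proj₂ t)))
    y<z = proj₂ (proj₂ (proj₂ (proj₂ t)))
    ordered : {u v : Fin n} → toℕ u < toℕ v → u ≢ v
    ordered u<v u≡v = <-irrefl (cong toℕ u≡v) u<v

  b⁺ : (k : ℕ) → .(3 + k ≤ 2 * g) → Vertex n g
  b⁺ k q = bAt (suc (suc k)) q

  b⁺∉T : ∀ k .(q : 3 + k ≤ 2 * g) → ¬ InVT (b⁺ k q)
  b⁺∉T k q (inj₁ ())
  b⁺∉T k q (inj₂ (inj₁ ()))
  b⁺∉T k q (inj₂ (inj₂ ()))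

  c∉T : ¬ InVT c
  c∉T (inj₁ ())
  c∉T (inj₂ (inj₁ ()))
  c∉T (inj₂ (inj₂ ()))

  bNext-cases : ∀ i .(h : suc i ≤ 2 * g) →
                (Σ[ q ∈ suc (suc i) ≤ 2 * g ] bNext i h ≡ bAt (suc i) q)
                ⊎ (¬ suc (suc i) ≤ 2 * g × bNext i h ≡ b₁)
  bNext-cases i h with suc (suc i) ≤? 2 * g
  ... | yes q = inj₁ (q , refl)
  ... | no ¬q = inj₂ (¬q , refl)

  bNext-step : ∀ {i} .{h : suc i ≤ 2 * g} (q : suc (suc i) ≤ 2 * g) → bNext i h ≡ bAt (suc i) q
  bNext-step {i} {h} q with bNext-cases i h
  ... | inj₁ (_ , e)  = e
  ... | inj₂ (¬q , _) = contradiction q ¬q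

  bAt≢bNext : 0 < g → ∀ i .(h : suc i ≤ 2 * g) → bAt i h ≢ bNext i h
  bAt≢bNext 0<g i h with bNext-cases i h
  ... | inj₁ (q , e)  = λ e′ → inner i (trans e′ e)
    where
    inner : ∀ i .{h q} → bAt i h ≢ bAt (suc i) q
    inner zero          = b₁≢b₂
    inner (suc zero)    = λ ()
    inner (suc (suc _)) = λ ()
  ... | inj₂ (¬q , e) = λ e′ → wrapping i ¬q (trans e′ e)
    where
    wrapping : ∀ i .{h} → ¬ suc (suc i) ≤ 2 * g → bAt i h ≢ b₁
    wrapping zero          ¬q = contradiction (*-monoʳ-≤ 2 0<g) ¬q
    wrapping (suc zero)    _  = b₁≢b₂ ∘ sym
    wrapping (suc (suc _)) _  = λ ()

  b⁺≡bAt⇒ : ∀ {k i} .{q h} → b⁺ k q ≡ bAt i h → i ≡ suc (suc k)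
  b⁺≡bAt⇒ {i = zero}        ()
  b⁺≡bAt⇒ {i = suc zero}    ()
  b⁺≡bAt⇒ {i = suc (suc _)} refl = refl

  b⁺≡bNext⇒ : ∀ {k i} .{q h} → b⁺ k q ≡ bNext i h → i ≡ suc k
  b⁺≡bNext⇒ {i = i} {h = h} e with bNext-cases i h
  ... | inj₁ (_ , e′) = suc-injective (b⁺≡bAt⇒ (trans e e′))
  ... | inj₂ (_ , e′) with trans e e′
  ...   | ()

  position : ∀ {τ} → InB τ → ℕ
  position (inj₁ (i , _)) = toℕ i
  position (inj₂ (i , _)) = toℕ i

  position<2g : ∀ {τ} (p : InB τ) → position p < 2 * g
  position<2g (inj₁ (i , _)) = toℕ<n i
  position<2g (inj₂ (i , _)) = toℕ<n i

  apex : ∀ {τ} → InB τ → Vertex n g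
  apex (inj₁ (i , _)) = if even (toℕ i) then c else a
  apex (inj₂ (i , _)) = if even (toℕ i) then a else c

  shape : ∀ {τ} (p : InB τ) → SameTri τ (triAt (apex p) (position p) (position<2g p))
  shape (inj₁ (_ , same))     = same
  shape (inj₂ (_ , _ , same)) = same

  bAt∈ : ∀ {τ i} (p : InB τ) → position p ≡ i → .(h : suc i ≤ 2 * g) → bAt i h ∈ₜ τ
  bAt∈ p refl h = proj₂ (shape p _) (inj₂ (inj₁ refl))

  bNext∈ : ∀ {τ i} (p : InB τ) → position p ≡ i → .(h : suc i ≤ 2 * g) → bNext i h ∈ₜ τ
  bNext∈ p refl h = proj₂ (shape p _) (inj₂ (inj₂ refl))

  c∈ : ∀ {τ} (p : InB τ) → position p ≡ 0 → c ∈ₜ τ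
  c∈ p@(inj₁ (i , _)) i≡0 = proj₂ (shape p c) (inj₁ (sym (cong (λ m → if even m then c else a) i≡0)))
  c∈ (inj₂ (i , i≢0 , _)) i≡0 = contradiction i≡0 i≢0

  b⁺≢apex : ∀ {τ k} .{q} (p : InB τ) → b⁺ k q ≢ apex p
  b⁺≢apex (inj₁ (i , _)) with even (toℕ i)
  ... | true  = λ ()
  ... | false = λ ()
  b⁺≢apex (inj₂ (i , _)) with even (toℕ i)
  ... | true  = λ ()
  ... | false = λ ()

  b⁺∈⇒ : ∀ {τ k} .{q} (p : InB τ) → b⁺ k q ∈ₜ τ →
         position p ≡ suc (suc k) ⊎ position p ≡ suc k
  b⁺∈⇒ p b⁺∈τ with proj₁ (shape p _) b⁺∈τ
  ... | inj₁ e          = contradiction e (b⁺≢apex p)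
  ... | inj₂ (inj₁ e)   = inj₁ (b⁺≡bAt⇒ e)
  ... | inj₂ (inj₂ e)   = inj₂ (b⁺≡bNext⇒ e)

  same-position⇒shareEdge : 0 < g → ∀ {τ σ} (p : InB τ) (p′ : InB σ) →
                            position p ≡ position p′ → ShareEdge τ σ
  same-position⇒shareEdge 0<g p p′ e =
    bAt i h , bNext i h , bAt≢bNext 0<g i h ,
    bAt∈ p refl h , bNext∈ p refl h , bAt∈ p′ (sym e) h , bNext∈ p′ (sym e) h
    where
    i : ℕ
    i = position p
    h : suc i ≤ 2 * g
    h = position<2g p

  module Family (0<g : 0 < g) (E : List Tri) (E⊆B : All InB E)
                (disjoint : AllPairs (λ τ σ → ¬ ShareEdge τ σ) E) where

    member : (r : Fin (length E)) → InB (lookup E r)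
    member r = All.lookup E⊆B (∈-lookup r)

    pos : Fin (length E) → ℕ
    pos r = position (member r)

    pos-injective : ∀ {r r′} → pos r ≡ pos r′ → r ≡ r′
    pos-injective {r} {r′} e with Fin.<-cmp r r′
    ... | tri≈ _ r≡r′ _ = r≡r′
    ... | tri< r<r′ _ _ = contradiction (same-position⇒shareEdge 0<g (member r) (member r′) e)
                                        (allPairs-lookup disjoint r<r′)
    ... | tri> _ _ r′<r = contradiction (same-position⇒shareEdge 0<g (member r′) (member r) (sym e))
                                        (allPairs-lookup disjoint r′<r)

    Occupied : ℕ → Set
    Occupied i = ∃[ r ] pos r ≡ i

    occupied? : ∀ i → Dec (Occupied i)
    occupied? i = any? (λ r → pos r ≟ i)

    LoneVertex : Set
    LoneVertex = Σ[ v ∈ Vertex n g ] (InVB v × ¬ InVT v × ExactlyOne E v)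

    lone-in : ∀ {v} r → v ∈ₜ lookup E r → ¬ InVT v →
           (∀ r′ → v ∈ₜ lookup E r′ → pos r′ ≡ pos r) → LoneVertex
    lone-in r v∈ v∉T only-r = _ , (lookup E r , member r , v∈) , v∉T ,
                           r , v∈ , λ r′ v∈′ → pos-injective (only-r r′ v∈′)

    c-lone : Fin (length E) → (∀ r → pos r ≡ 0) → LoneVertex
    c-lone r all-zero = lone-in r (c∈ (member r) (all-zero r)) c∉T
                             (λ r′ _ → trans (all-zero r′) (sym (all-zero r)))

    b⁺-lone : ∀ k (q : 3 + k ≤ 2 * g) →
              does (occupied? (suc k)) ≢ does (occupied? (suc (suc k))) → LoneVertex
    b⁺-lone k q change with occupied? (suc k) | occupied? (suc (suc k))
    ... | yes _ | yes _ = contradiction refl change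
    ... | no _  | no _  = contradiction refl change
    ... | yes (r , e) | no free =
      lone-in r (subst (_∈ₜ lookup E r) (bNext-step q) (bNext∈ (member r) e (<⇒≤ q))) (b⁺∉T k q)
           (λ r′ m → [ (λ e′ → contradiction (r′ , e′) free) , (λ e′ → trans e′ (sym e)) ]′
                       (b⁺∈⇒ (member r′) m))
    ... | no free | yes (r , e) =
      lone-in r (bAt∈ (member r) e q) (b⁺∉T k q)
           (λ r′ m → [ (λ e′ → trans e′ (sym e)) , (λ e′ → contradiction (r′ , e′) free) ]′
                       (b⁺∈⇒ (member r′) m))

    NewVertices : Set
    NewVertices = Σ[ vs ∈ List (Vertex n g) ]
                    (Unique vs × length E ≤ length vs × All (λ v → InVE E v × ¬ InVT v) vs)

    module FreePosition (j : ℕ) (1≤j : 1 ≤ j) (j+2≤2g : 2 + j ≤ 2 * g) (j-free : ¬ Occupied j) where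

      loneVertex : E ≢ [] → LoneVertex
      loneVertex E≢[] with any? (λ r → 1 ≤? pos r)
      ... | no none = c-lone (nonempty-index E≢[]) (λ r → n<1⇒n≡0 (≰⇒> (none ∘ (r ,_))))
      ... | yes (s , 1≤s)
            with change-point-within (does ∘ occupied?) 1≤j 1≤s (<⇒≤ j+2≤2g) (position<2g (member s))
                   (does-distinct (occupied? j) (occupied? (pos s)) j-free (s , refl))
      ...   | suc k , _ , q , change = b⁺-lone k q change

      decode : Vertex n g → ℕ
      decode (inj₂ (_ , bnew k _)) with suc k <? j
      ... | yes _ = suc k
      ... | no _  = suc (suc k)
      decode _ = 0

      decode-below : ∀ k .{q} → suc k < j → decode (b⁺ k q) ≡ suc k
      decode-below k k+1<j with suc k <? j
      ... | yes _   = refl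
      ... | no k+1≮j = contradiction k+1<j k+1≮j

      decode-above : ∀ k .{q} → ¬ suc k < j → decode (b⁺ k q) ≡ suc (suc k)
      decode-above k k+1≮j with suc k <? j
      ... | yes k+1<j = contradiction k+1<j k+1≮j
      ... | no _      = refl

      record Representative (τ : Tri) (i : ℕ) : Set where
        constructor representing
        field
          vertex   : Vertex n g
          vertex∈τ : vertex ∈ₜ τ
          vertex∉T : ¬ InVT vertex
          decodes  : decode vertex ≡ i
      open Representative

      representative : ∀ {τ} (p : InB τ) i → position p ≡ i → i ≢ j → Representative τ i
      representative p zero e _ = representing c (c∈ p e) c∉T refl
      representative p (suc i) e i≢j with suc i <? j
      ... | yes i<j = representing (b⁺ i q) (subst (_∈ₜ _) (bNext-step q) (bNext∈ p e (<⇒≤ q)))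
                                   (b⁺∉T i q) (decode-below i i<j)
        where
        q : 3 + i ≤ 2 * g
        q = ≤-trans (s≤s i<j) (<⇒≤ j+2≤2g)
      representative p (suc zero) e i≢j | no i≮j = contradiction (≤-antisym 1≤j (≮⇒≥ i≮j)) i≢j
      representative p (suc (suc k)) e i≢j | no i≮j =
        representing (b⁺ k q) (bAt∈ p e q) (b⁺∉T k q)
                     (decode-above k (λ k+1<j → i≢j (≤-antisym k+1<j (≮⇒≥ i≮j))))
        where
        q : 3 + k ≤ 2 * g
        q = subst (_< 2 * g) e (position<2g p)

      representativeOf : (r : Fin (length E)) → Representative (lookup E r) (pos r)
      representativeOf r = representative (member r) (pos r) refl (j-free ∘ (r ,_))

      representativeOf-injective : ∀ {r r′} →
        vertex (representativeOf r) ≡ vertex (representativeOf r′) → r ≡ r′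
      representativeOf-injective {r} {r′} e = pos-injective (begin
        pos r                                ≡⟨ decodes (representativeOf r) ⟨
        decode (vertex (representativeOf r))  ≡⟨ cong decode e ⟩
        decode (vertex (representativeOf r′)) ≡⟨ decodes (representativeOf r′) ⟩
        pos r′                               ∎)
        where open ≡-Reasoning

      newVertices : NewVertices
      newVertices =
        tabulate (vertex ∘ representativeOf) ,
        Unique.tabulate⁺ representativeOf-injective ,
        ≤-reflexive (sym (length-tabulate _)) ,
        All.tabulate⁺ (λ r → lose (∈-lookup r) (vertex∈τ (representativeOf r)) , vertex∉T (representativeOf r))

lemma4p9 : (g : ℕ) → 2 < g → (n : ℕ) → (lab : Labelling n) → (t : Triple n)
    → (E : List (Tri' (Vertex n g)))
    → All (Sphere.InB {n} {g} lab t) E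
    → E ≢ []
    → length E ≤ g
    → AllPairs (λ τ σ → ¬ ShareEdge τ σ) E
    → (Σ[ v ∈ Vertex n g ] (Sphere.InVB {n} {g} lab t v × ¬ Sphere.InVT {n} {g} lab t v × ExactlyOne E v))
      × (Σ[ vs ∈ List (Vertex n g) ] (Unique vs × length E ≤ length vs
           × All (λ v → InVE E v × ¬ Sphere.InVT {n} {g} lab t v) vs))
lemma4p9 g 2<g n lab t E E⊆B E≢[] |E|≤g disjoint =
  let open Cover.Family {n} {g} lab t (≤-trans (s≤s z≤n) 2<g) E E⊆B disjoint
      (j , 1≤j , j≤|E|+1 , j-free) = missed-value pos
      j+2≤2g : 2 + j ≤ 2 * g
      j+2≤2g = ≤-trans (+-monoʳ-≤ 2 (≤-trans j≤|E|+1 (s≤s |E|≤g))) (3+g≤2*g 2<g)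
      open FreePosition j 1≤j j+2≤2g j-free
  in loneVertex E≢[] , newVertices
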